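{- Let $(T,<,\{G_x\}_{x\in V(T)})$ be a distinguishing delayed decomposition of an ordered graph $(G,<)$. If $x$ is a node of $T$ with at least $3$ children, then there are no two consecutive children $y_1,y_2$ of $x$ that are both labelled $O$.
   Context: For a rooted tree $T$, $L(T)$ is its set of leaves, $L(x)$ the set of leaves descending from node $x$, and $p^2(x)$ the grandparent of $x$; cousins are non-sibling nodes with the same grandparent. An ordered tree $(T,<)$ is a rooted tree with a linear order $<$ on $L(T)$ such that each $L(x)$ is an interval of $<$; for nodes $x,y$ not in ancestor–descendant relation, $x<y$ means $L(x)<L(y)$, which orders the children of every node (consecutive children refers to this order). A delayed structured tree $(T,<,\{G_x\})$ is an ordered tree in which every leaf is the only child of its parent, with for each node $x$ a graph $G_x$ on the grandchildren of $x$; its realization is the ordered graph on $L(T)$ (ordered by $<$) where leaves $u,v$ are adjacent iff $u'v'\in E(G_z)$, $z$ being their closest common ancestor and $u',v'$ the grandchildren of $z$ above $u,v$. It is a delayed decomposition of $(G,<)$ if its realization is $(G,<)$, and it is distinguishing if for every node $x$ with at least $3$ children and any two consecutive children $x_1,x_2$ of $x$ there is $v\in V(G)\setminus L(x)$ adjacent to all vertices of one of $L(x_1),L(x_2)$ and to none of the other. Labels: a node without grandparent is labelled $\emptyset$; otherwise a node $x$ is labelled $R$ if some cousin $x'$ with $x<x'$ satisfies $xx'\in E(G_{p^2(x)})$; otherwise $L$ if some cousin $x'$ with $x'<x$ satisfies $xx'\in E(G_{p^2(x)})$; otherwise $O$. -}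

module Defs where

open import Data.Nat using (ℕ; zero; suc; _≤_)
open import Data.Fin using (Fin; toℕ) renaming (_<_ to _<ᶠ_)
open import Data.Product using (Σ; _×_; _,_; proj₁; proj₂; ∃)
open import Data.Sum using (_⊎_)
open import Function.Bundles using (_⇔_)
open import Relation.Binary.PropositionalEquality using (_≡_; _≢_)
open import Relation.Nullary using (¬_)

-- The linear order
-- on the leaves is the left-to-right (lexicographic) order, so every L(x)
-- is automatically an interval.

data Tree : Set where
  node : (k : ℕ) → (Fin k → Tree) → Tree

arity : Tree → ℕ
arity (node k _) = k

child : (s : Tree) → Fin (arity s) → Tree
child (node k c) i = c i

-- Positions (nodes) of t, indexed by the subtree rooted there.
-- Paths grow at the bottom: (p ▸ i) is the i-th child of p.
data Pos (t : Tree) : Tree → Set where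
  root : Pos t t
  _▸_  : ∀ {s} → Pos t s → (i : Fin (arity s)) → Pos t (child s i)

infixl 5 _▸_

Node : Tree → Set
Node t = Σ Tree (Pos t)

data _⊑_ {t : Tree} : Node t → Node t → Set where
  ⊑-refl : ∀ {x} → x ⊑ x
  ⊑-step : ∀ {x s} {p : Pos t s} (i : Fin (arity s)) →
           x ⊑ (s , p) → x ⊑ (child s i , p ▸ i)

IsLeaf : ∀ {t} → Node t → Set
IsLeaf x = arity (proj₁ x) ≡ 0

Leaf : Tree → Set
Leaf t = Σ (Node t) IsLeaf

_<ᴸ_ : ∀ {t} → Leaf t → Leaf t → Set
_<ᴸ_ {t} u v = Σ Tree λ s → Σ (Pos t s) λ z → Σ (Fin (arity s)) λ i → Σ (Fin (arity s)) λ j →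
  i <ᶠ j × (child s i , z ▸ i) ⊑ proj₁ u × (child s j , z ▸ j) ⊑ proj₁ v

_<ᴺ_ : ∀ {t} → Node t → Node t → Set
_<ᴺ_ {t} x y = ¬ (x ⊑ y) × ¬ (y ⊑ x) ×
  ((u v : Leaf t) → x ⊑ proj₁ u → y ⊑ proj₁ v → u <ᴸ v)

Consecutive : ∀ {k} → Fin k → Fin k → Set
Consecutive i j = toℕ j ≡ suc (toℕ i)

-- Grandchildren of a node with subtree s: pairs (child b, child a of b)

GC : Tree → Set
GC s = Σ (Fin (arity s)) λ b → Fin (arity (child s b))

gcNode : ∀ {t s} → Pos t s → GC s → Node t
gcNode z (b , a) = (_ , z ▸ b ▸ a)

record DelayedStructuredTree : Set₁ where
  field
    tree    : Tree
    delayed : ∀ {s} (p : Pos tree s) (i : Fin (arity s)) →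
              arity (child s i) ≡ 0 → arity s ≡ 1
    G       : ∀ {s} → Pos tree s → GC s → GC s → Set
    G-sym   : ∀ {s} (z : Pos tree s) {u v : GC s} → G z u v → G z v u
    G-irr   : ∀ {s} (z : Pos tree s) {u : GC s} → ¬ G z u u

data Label : Set where
  ∅ᴸ Rᴸ Lᴸ Oᴸ : Label

module _ (T : DelayedStructuredTree) where
  open DelayedStructuredTree T

  -- adjacency in the realization: z is the closest common ancestor of the
  -- leaves u, v (the children of z above them differ) and the grandchildren
  -- u', v' of z above u, v are adjacent in G_z
  RealizationAdj : Leaf tree → Leaf tree → Set
  RealizationAdj u v = Σ Tree λ s → Σ (Pos tree s) λ z → Σ (GC s) λ u' → Σ (GC s) λ v' →
    proj₁ u' ≢ proj₁ v' × gcNode z u' ⊑ proj₁ u × gcNode z v' ⊑ proj₁ v × G z u' v'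

  -- (G,<) with vertex set L(T), ordered by <ᴸ, and edge relation E
  IsDelayedDecompositionOf : (Leaf tree → Leaf tree → Set) → Set
  IsDelayedDecompositionOf E = (u v : Leaf tree) → E u v ⇔ RealizationAdj u v

  IsDistinguishing : (Leaf tree → Leaf tree → Set) → Set
  IsDistinguishing E = ∀ {s} (x : Pos tree s) → 3 ≤ arity s →
    (i j : Fin (arity s)) → Consecutive i j →
    ∃ λ (v : Leaf tree) → ¬ ((s , x) ⊑ proj₁ v) ×
      ( ( ((u : Leaf tree) → (child s i , x ▸ i) ⊑ proj₁ u → E v u)
        × ((u : Leaf tree) → (child s j , x ▸ j) ⊑ proj₁ u → ¬ E v u) )
      ⊎ ( ((u : Leaf tree) → (child s j , x ▸ j) ⊑ proj₁ u → E v u)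
        × ((u : Leaf tree) → (child s i , x ▸ i) ⊑ proj₁ u → ¬ E v u) ) )

  RightAdj : ∀ {s} → Pos tree s → GC s → Set
  RightAdj {s} z c = Σ (GC s) λ c' →
    proj₁ c' ≢ proj₁ c × gcNode z c <ᴺ gcNode z c' × G z c c'

  LeftAdj : ∀ {s} → Pos tree s → GC s → Set
  LeftAdj {s} z c = Σ (GC s) λ c' →
    proj₁ c' ≢ proj₁ c × gcNode z c' <ᴺ gcNode z c × G z c c'

  data HasLabel : Node tree → Label → Set where
    lab-root  : HasLabel (tree , root) ∅ᴸ
    lab-child : (i : Fin (arity tree)) → HasLabel (_ , root ▸ i) ∅ᴸ
    lab-R     : ∀ {s} (z : Pos tree s) (c : GC s) →
                RightAdj z c → HasLabel (gcNode z c) Rᴸ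
    lab-L     : ∀ {s} (z : Pos tree s) (c : GC s) →
                ¬ RightAdj z c → LeftAdj z c → HasLabel (gcNode z c) Lᴸ
    lab-O     : ∀ {s} (z : Pos tree s) (c : GC s) →
                ¬ RightAdj z c → ¬ LeftAdj z c → HasLabel (gcNode z c) Oᴸ

-- A distinguishing vertex v for the consecutive children y₁, y₂ of x lies outside L(x) and,
-- say, is adjacent to all of L(y₁) and to none of L(y₂).  Pick a leaf u below y₁; the
-- realization puts a grandchild u' of the closest common ancestor z of u and v above u.
-- Since v ∉ L(x), z is not below x, so u' is either y₁ itself or an ancestor of x.  In the
-- latter case u' is also above every leaf of L(y₂), which would then be adjacent to v.
-- In the former case z = p²(y₁) and G_z has an edge from y₁ to a cousin, so y₁ is not
-- labelled O.
module Submission where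

open import Defs
open import Data.Nat using (ℕ; zero; suc; _≤_)
open import Data.Nat.Properties using (≤-refl; ≤-trans; n≤1+n; 1+n≰n; <⇒≢)
open import Data.Fin using (Fin; toℕ) renaming (_<_ to _<ᶠ_; zero to fzero)
open import Data.Fin.Properties using (<-cmp)
open import Data.Product using (Σ; _×_; _,_; proj₁; proj₂)
open import Data.Sum using (_⊎_; inj₁; inj₂; map₂)
open import Relation.Nullary using (¬_)
open import Relation.Binary using (tri<; tri≈; tri>)
open import Relation.Binary.PropositionalEquality using (_≡_; _≢_; refl; sym; cong)
open import Function.Bundles using (Equivalence)

module _ {t : Tree} where

  -- the root is its own parent
  parent : Node t → Node t
  parent (_ , root)  = (_ , root)
  parent (_ , p ▸ _) = (_ , p)

  depth : ∀ {s} → Pos t s → ℕ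
  depth root    = 0
  depth (p ▸ _) = suc (depth p)

  -- the child of p²(x) above x, as a number (0 for nodes of depth < 2)
  grandparentBranch : ∀ {s} → Pos t s → ℕ
  grandparentBranch (_ ▸ i ▸ _) = toℕ i
  grandparentBranch _           = 0

  ⊑-trans : {x y z : Node t} → x ⊑ y → y ⊑ z → x ⊑ z
  ⊑-trans p ⊑-refl       = p
  ⊑-trans p (⊑-step i q) = ⊑-step i (⊑-trans p q)

  parent-⊑ : (x : Node t) → parent x ⊑ x
  parent-⊑ (_ , root)  = ⊑-refl
  parent-⊑ (_ , _ ▸ i) = ⊑-step i ⊑-refl

  grandparent-⊑ : ∀ {s} (z : Pos t s) (c : GC s) → (s , z) ⊑ gcNode z c
  grandparent-⊑ z (b , a) = ⊑-step a (⊑-step b ⊑-refl)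

  ⊑-≡⊎⊑parent : {x y : Node t} → x ⊑ y → x ≡ y ⊎ x ⊑ parent y
  ⊑-≡⊎⊑parent ⊑-refl       = inj₁ refl
  ⊑-≡⊎⊑parent (⊑-step _ q) = inj₂ q

  parent-mono : {x y : Node t} → x ⊑ y → parent x ⊑ parent y
  parent-mono {x} q with ⊑-≡⊎⊑parent q
  ... | inj₁ refl = ⊑-refl
  ... | inj₂ q′   = ⊑-trans (parent-⊑ x) q′

  ⊑-total-below : {x y z : Node t} → x ⊑ z → y ⊑ z → x ⊑ y ⊎ y ⊑ x
  ⊑-total-below ⊑-refl       q = inj₂ q
  ⊑-total-below (⊑-step i p) q with ⊑-≡⊎⊑parent q
  ... | inj₁ refl = inj₁ (⊑-step i p)
  ... | inj₂ q′   = ⊑-total-below p q′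

  ⊑-depth : {x y : Node t} → x ⊑ y → depth (proj₂ x) ≤ depth (proj₂ y)
  ⊑-depth ⊑-refl       = ≤-refl
  ⊑-depth (⊑-step _ q) = ≤-trans (⊑-depth q) (n≤1+n _)

  leafBelow : ∀ s (p : Pos t s) → Σ (Leaf t) λ u → (s , p) ⊑ proj₁ u
  leafBelow (node zero _)    p = ((_ , p) , refl) , ⊑-refl
  leafBelow (node (suc _) c) p with leafBelow (c fzero) (p ▸ fzero)
  ... | u , q = u , ⊑-trans (⊑-step fzero ⊑-refl) q

  ⊑-trichotomy-below : {x y z : Node t} → x ⊑ z → y ⊑ z → y ≡ x ⊎ y ⊑ parent x ⊎ x ⊑ parent y
  ⊑-trichotomy-below p q with ⊑-total-below p q
  ... | inj₂ y⊑x = map₂ inj₁ (⊑-≡⊎⊑parent y⊑x)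
  ... | inj₁ x⊑y with ⊑-≡⊎⊑parent x⊑y
  ...   | inj₁ refl = inj₁ refl
  ...   | inj₂ x⊑py = inj₂ (inj₂ x⊑py)

  gcNode-⋢ : ∀ {s} (z : Pos t s) (b b′ : Fin (arity s)) a a′ → toℕ b ≢ toℕ b′ →
             ¬ (gcNode z (b , a) ⊑ gcNode z (b′ , a′))
  gcNode-⋢ z b b′ a a′ b≢b′ le with ⊑-≡⊎⊑parent le
  ... | inj₁ eq = b≢b′ (cong (λ n → grandparentBranch (proj₂ n)) eq)
  ... | inj₂ le′ = 1+n≰n (⊑-depth le′)

  gcNode-<ᴺ : ∀ {s} (z : Pos t s) (b b′ : Fin (arity s)) a a′ → b <ᶠ b′ →
              gcNode z (b , a) <ᴺ gcNode z (b′ , a′)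
  gcNode-<ᴺ z b b′ a a′ b<b′ =
    gcNode-⋢ z b b′ a a′ (<⇒≢ b<b′) ,
    gcNode-⋢ z b′ b a′ a (λ e → <⇒≢ b<b′ (sym e)) ,
    λ u v pu pv → _ , z , b , b′ , b<b′ , ⊑-trans (⊑-step a ⊑-refl) pu , ⊑-trans (⊑-step a′ ⊑-refl) pv

module _ (T : DelayedStructuredTree) where
  open DelayedStructuredTree T

  O-no-cousin-edge : ∀ {s} (z : Pos tree s) (c : GC s) → ¬ RightAdj T z c → ¬ LeftAdj T z c →
                     ∀ {s′} (z′ : Pos tree s′) (u v : GC s′) → gcNode z′ u ≡ gcNode z c →
                     proj₁ u ≢ proj₁ v → ¬ G z′ u v
  O-no-cousin-edge z (b , a) ¬R ¬L z′ u v eq u≢v g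
    with cong (λ n → parent (parent n)) eq
  ... | refl with u | eq
  ... | (.b , .a) | refl with <-cmp b (proj₁ v)
  ... | tri< b<v _ _ = ¬R (v , (λ e → u≢v (sym e)) , gcNode-<ᴺ z b (proj₁ v) a (proj₂ v) b<v , g)
  ... | tri≈ _ b≡v _ = u≢v b≡v
  ... | tri> _ _ v<b = ¬L (v , (λ e → u≢v (sym e)) , gcNode-<ᴺ z (proj₁ v) b (proj₂ v) a v<b , g)

  module _ (E : Leaf tree → Leaf tree → Set) (dec : IsDelayedDecompositionOf T E) where

    O-not-distinguished : ∀ {s} (z : Pos tree s) (b : Fin (arity s)) (a a′ : Fin (arity (child s b))) →
      ¬ RightAdj T z (b , a) → ¬ LeftAdj T z (b , a) →
      (v : Leaf tree) → ¬ ((child s b , z ▸ b) ⊑ proj₁ v) →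
      ((u : Leaf tree) → gcNode z (b , a) ⊑ proj₁ u → E v u) →
      ¬ ((u : Leaf tree) → gcNode z (b , a′) ⊑ proj₁ u → ¬ E v u)
    O-not-distinguished z b a a′ ¬R ¬L v v∉Lx adjAll adjNone
      with leafBelow _ (z ▸ b ▸ a) | leafBelow _ (z ▸ b ▸ a′)
    ... | u , a⊑u | w , a′⊑w
      with Equivalence.to (dec v u) (adjAll u a⊑u)
    ... | s′ , z′ , v″ , u″ , v″≢u″ , v″⊑v , u″⊑u , g
      with ⊑-trichotomy-below a⊑u u″⊑u
    ... | inj₁ eq = O-no-cousin-edge z (b , a) ¬R ¬L z′ u″ v″ eq (λ e → v″≢u″ (sym e)) (G-sym z′ g)
    ... | inj₂ (inj₁ u″⊑x) = adjNone w a′⊑w (Equivalence.from (dec v w)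
          (s′ , z′ , v″ , u″ , v″≢u″ , v″⊑v , ⊑-trans u″⊑x (⊑-trans (⊑-step a′ ⊑-refl) a′⊑w) , g))
    ... | inj₂ (inj₂ a⊑pu″) = v∉Lx (⊑-trans (parent-mono a⊑pu″)
          (⊑-trans (grandparent-⊑ z′ v″) v″⊑v))

lemma15 : (T : DelayedStructuredTree) →
    (E : Leaf (DelayedStructuredTree.tree T) → Leaf (DelayedStructuredTree.tree T) → Set) →
    IsDelayedDecompositionOf T E → IsDistinguishing T E →
    ∀ {s} (x : Pos (DelayedStructuredTree.tree T) s) → 3 ≤ arity s →
    (y₁ y₂ : Fin (arity s)) → Consecutive y₁ y₂ →
    ¬ (HasLabel T (_ , x ▸ y₁) Oᴸ × HasLabel T (_ , x ▸ y₂) Oᴸ)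
lemma15 T E dec dist .(z ▸ b) 3≤k .a₁ .a₂ consec (lab-O z (b , a₁) ¬R₁ ¬L₁ , lab-O .z (.b , a₂) ¬R₂ ¬L₂)
  with dist (z ▸ b) 3≤k a₁ a₂ consec
... | v , v∉Lx , inj₁ (adj₁ , ¬adj₂) = O-not-distinguished T E dec z b a₁ a₂ ¬R₁ ¬L₁ v v∉Lx adj₁ ¬adj₂
... | v , v∉Lx , inj₂ (adj₂ , ¬adj₁) = O-not-distinguished T E dec z b a₂ a₁ ¬R₂ ¬L₂ v v∉Lx adj₂ ¬adj₁
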